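{- Let $\varphi$ be a bimodal formula. If $(\underline{A}_j\mid j\in J)$ is a finite family of subordination algebras then \[ \prod_{j\in J}\underline{A}_j\models\varphi \iff \underline{A}_j\models\varphi\ \text{ for all } j. \]
   Context: Subordination algebra: $(B,\prec)$, $B$ Boolean, each $\prec(b,-)$ a filter and each $\prec(-,b)$ an ideal; the product is the Cartesian product with $\prec$ defined pointwise. Bimodal formulas use $\vee,\wedge,\neg,\top,\bot$, the white diamond $\lozenge$ and the black diamond, written here $\lozenge^{ - }$. They are evaluated, for valuations of variables into $B$, in the canonical extension $\mathcal{P}(\mathrm{Ult}(B))$ (via $b\mapsto\{x\mid b\in x\}$) with $\lozenge E=R(-,E)$, $\lozenge^{ - }E=R(E,-)$, where $x\mathrel{R}y$ iff $\prec(y,-)\subseteq x$; $\underline{B}\models\varphi$ means $\varphi$ evaluates to the top under every valuation. -}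

module Defs where

open import Level using (Level; suc)
open import Data.Nat using (ℕ)
open import Data.Fin using (Fin)
open import Data.Product using (Σ; _×_; _,_; proj₁; proj₂)
open import Data.Sum using (_⊎_)
open import Data.Unit.Polymorphic renaming (⊤ to 𝟙)
open import Data.Empty.Polymorphic renaming (⊥ to 𝟘)
open import Relation.Nullary renaming (¬_ to Not)
open import Algebra.Lattice.Bundles using (BooleanAlgebra)

module _ {a : Level} (B : BooleanAlgebra a a) where
  open BooleanAlgebra B

  _≤ᴮ_ : Carrier → Carrier → Set a
  x ≤ᴮ y = (x ∧ y) ≈ x

  record IsFilter (F : Carrier → Set a) : Set a where
    field
      top∈   : F ⊤
      upward : ∀ {x y} → F x → x ≤ᴮ y → F y
      meet   : ∀ {x y} → F x → F y → F (x ∧ y)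

  record IsIdeal (I : Carrier → Set a) : Set a where
    field
      bot∈     : I ⊥
      downward : ∀ {x y} → I y → x ≤ᴮ y → I x
      join     : ∀ {x y} → I x → I y → I (x ∨ y)

  record IsUltrafilter (U : Carrier → Set a) : Set a where
    field
      isFilter : IsFilter U
      proper   : Not (U ⊥)
      prime    : ∀ x → U x ⊎ U (¬ x)

record SubordinationAlgebra (a : Level) : Set (suc a) where
  field
    booleanAlgebra : BooleanAlgebra a a
  open BooleanAlgebra booleanAlgebra public
  field
    _≺_       : Carrier → Carrier → Set a
    ≺-filter  : ∀ b → IsFilter booleanAlgebra (λ c → b ≺ c)
    ≺-ideal   : ∀ b → IsIdeal  booleanAlgebra (λ c → c ≺ b)

module _ {a : Level} {n : ℕ} (A : Fin n → BooleanAlgebra a a) where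
  private module A i = BooleanAlgebra (A i)

  ∏BA : BooleanAlgebra a a
  ∏BA = record
    { Carrier = (i : Fin n) → A.Carrier i
    ; _≈_ = λ f g → ∀ i → A._≈_ i (f i) (g i)
    ; _∨_ = λ f g i → A._∨_ i (f i) (g i)
    ; _∧_ = λ f g i → A._∧_ i (f i) (g i)
    ; ¬_ = λ f i → A.¬_ i (f i)
    ; ⊤ = λ i → A.⊤ i
    ; ⊥ = λ i → A.⊥ i
    ; isBooleanAlgebra = record
      { isDistributiveLattice = record
        { isLattice = record
          { isEquivalence = record
            { refl = λ i → A.refl i
            ; sym = λ p i → A.sym i (p i)
            ; trans = λ p q i → A.trans i (p i) (q i) }
          ; ∨-comm = λ f g i → A.∨-comm i (f i) (g i)
          ; ∨-assoc = λ f g h i → A.∨-assoc i (f i) (g i) (h i)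
          ; ∨-cong = λ p q i → A.∨-cong i (p i) (q i)
          ; ∧-comm = λ f g i → A.∧-comm i (f i) (g i)
          ; ∧-assoc = λ f g h i → A.∧-assoc i (f i) (g i) (h i)
          ; ∧-cong = λ p q i → A.∧-cong i (p i) (q i)
          ; absorptive = (λ f g i → proj₁ (A.absorptive i) (f i) (g i))
                       , (λ f g i → proj₂ (A.absorptive i) (f i) (g i)) }
        ; ∨-distrib-∧ = (λ f g h i → A.∨-distribˡ-∧ i (f i) (g i) (h i))
                      , (λ f g h i → A.∨-distribʳ-∧ i (f i) (g i) (h i))
        ; ∧-distrib-∨ = (λ f g h i → A.∧-distribˡ-∨ i (f i) (g i) (h i))
                      , (λ f g h i → A.∧-distribʳ-∨ i (f i) (g i) (h i)) }
      ; ∨-complement = (λ f i → A.∨-complementˡ i (f i))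
                     , (λ f i → A.∨-complementʳ i (f i))
      ; ∧-complement = (λ f i → A.∧-complementˡ i (f i))
                     , (λ f i → A.∧-complementʳ i (f i))
      ; ¬-cong = λ p i → A.¬-cong i (p i) } }

module _ {a : Level} {n : ℕ} (A : Fin n → SubordinationAlgebra a) where
  private module A i = SubordinationAlgebra (A i)

  ∏ : SubordinationAlgebra a
  ∏ = record
    { booleanAlgebra = ∏BA (λ i → A.booleanAlgebra i)
    ; _≺_ = λ f g → ∀ i → A._≺_ i (f i) (g i)
    ; ≺-filter = λ f → record
      { top∈ = λ i → IsFilter.top∈ (A.≺-filter i (f i))
      ; upward = λ p q i → IsFilter.upward (A.≺-filter i (f i)) (p i) (q i)
      ; meet = λ p q i → IsFilter.meet (A.≺-filter i (f i)) (p i) (q i) }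
    ; ≺-ideal = λ f → record
      { bot∈ = λ i → IsIdeal.bot∈ (A.≺-ideal i (f i))
      ; downward = λ p q i → IsIdeal.downward (A.≺-ideal i (f i)) (p i) (q i)
      ; join = λ p q i → IsIdeal.join (A.≺-ideal i (f i)) (p i) (q i) } }

data Formula : Set where
  var      : ℕ → Formula
  _∨ᶠ_ _∧ᶠ_ : Formula → Formula → Formula
  ¬ᶠ_      : Formula → Formula
  ⊤ᶠ ⊥ᶠ    : Formula
  ◇ ◆      : Formula → Formula

-- Semantics in the canonical extension 𝒫(Ult B)

module _ {a : Level} (S : SubordinationAlgebra a) where
  open SubordinationAlgebra S

  Ult : Set (suc a)
  Ult = Σ (Carrier → Set a) (IsUltrafilter booleanAlgebra)

  R : Ult → Ult → Set a
  R x y = ∀ b c → proj₁ y b → b ≺ c → proj₁ x c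

  Valuation : Set a
  Valuation = ℕ → Carrier

  -- subsets of Ult are predicates; ⟦ φ ⟧ v x means x ∈ ⟦φ⟧
  ⟦_⟧ : Formula → Valuation → Ult → Set (suc a)
  ⟦ var p ⟧   v x = Level.Lift (suc a) (proj₁ x (v p))
  ⟦ φ ∨ᶠ ψ ⟧ v x = ⟦ φ ⟧ v x ⊎ ⟦ ψ ⟧ v x
  ⟦ φ ∧ᶠ ψ ⟧ v x = ⟦ φ ⟧ v x × ⟦ ψ ⟧ v x
  ⟦ ¬ᶠ φ ⟧    v x = Not (⟦ φ ⟧ v x)
  ⟦ ⊤ᶠ ⟧      v x = 𝟙 {suc a}
  ⟦ ⊥ᶠ ⟧      v x = 𝟘 {suc a}
  ⟦ ◇ φ ⟧     v x = Σ Ult λ y → Level.Lift (suc a) (R x y) × ⟦ φ ⟧ v y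
  ⟦ ◆ φ ⟧     v y = Σ Ult λ x → Level.Lift (suc a) (R x y) × ⟦ φ ⟧ v x

  _⊨_ : Formula → Set (suc a)
  _⊨_ φ = ∀ (v : Valuation) (x : Ult) → ⟦ φ ⟧ v x

-- The ultrafilters of a finite product ∏ A correspond to the disjoint union of the
-- ultrafilters of the factors: each one contains exactly one unit e j (the element
-- that is ⊤ at j and ⊥ elsewhere) and is then the preimage of an ultrafilter of A j
-- under the j-th projection.  Since e j ≺ e j and ¬ e j ≺ ¬ e j, the canonical
-- relation of the product never leaves a component, so this correspondence is a
-- bisimulation between the canonical frames, and bimodal formulas are invariant
-- under bisimulations.
module Submission where

open import Defs
open import Level using (Level; lift)
open import Data.Nat using (ℕ)
open import Data.Fin using (Fin; _≟_)
open import Data.List using (List; []; _∷_; map; foldr; allFin)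
open import Data.List.Relation.Unary.Any using (Any; here; there; satisfied)
import Data.List.Relation.Unary.Any.Properties as Any
open import Data.List.Membership.Propositional using (_∈_)
open import Data.List.Membership.Propositional.Properties using (∈-allFin)
open import Data.Product using (Σ; _×_; _,_; proj₁; proj₂)
open import Data.Product.Function.NonDependent.Propositional using (_×-⇔_)
open import Data.Sum using (_⊎_; inj₁; inj₂; map₂)
open import Data.Sum.Function.Propositional using (_⊎-⇔_)
import Data.Empty as Empty
open import Data.Unit.Polymorphic using (tt)
open import Function.Bundles using (_⇔_; mk⇔; Equivalence)
open import Relation.Nullary using (yes; no)
open import Relation.Binary.PropositionalEquality using (refl)
open import Algebra.Lattice.Bundles using (BooleanAlgebra)
import Algebra.Lattice.Properties.BooleanAlgebra as BooleanAlgebraProperties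

open Equivalence using (to; from)

_∋_ : ∀ {a} {C : Set a} {P : (C → Set a) → Set a} →
      Σ (C → Set a) P → C → Set a
x ∋ b = proj₁ x b

module FilterProperties {a : Level} (B : BooleanAlgebra a a) where
  open BooleanAlgebra B
  open BooleanAlgebraProperties B

  ≈⇒≤ᴮ : ∀ {x y} → x ≈ y → _≤ᴮ_ B x y
  ≈⇒≤ᴮ {x} x≈y = trans (∧-congˡ (sym x≈y)) (∧-idem x)

  filter-resp-≈ : ∀ {F} → IsFilter B F → ∀ {x y} → F x → x ≈ y → F y
  filter-resp-≈ isF Fx x≈y = IsFilter.upward isF Fx (≈⇒≤ᴮ x≈y)

  ideal-resp-≈ : ∀ {I} → IsIdeal B I → ∀ {x y} → I x → x ≈ y → I y
  ideal-resp-≈ isI Ix x≈y = IsIdeal.downward isI Ix (≈⇒≤ᴮ (sym x≈y))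

  ⋁ : List Carrier → Carrier
  ⋁ = foldr _∨_ ⊥

  module _ {U : Carrier → Set a} (isU : IsUltrafilter B U) where
    open IsUltrafilter isU
    open IsFilter isFilter

    ultrafilter-resp-≈ : ∀ {x y} → U x → x ≈ y → U y
    ultrafilter-resp-≈ = filter-resp-≈ isFilter

    ultrafilter-∨ : ∀ {x y} → U (x ∨ y) → U x ⊎ U y
    ultrafilter-∨ {x} {y} Ux∨y with prime x
    ... | inj₁ Ux  = inj₁ Ux
    ... | inj₂ U¬x = inj₂ (upward (ultrafilter-resp-≈ (meet U¬x Ux∨y) ¬x∧[x∨y]≈¬x∧y) ¬x∧y≤y)
      where
      ¬x∧[x∨y]≈¬x∧y : (¬ x) ∧ (x ∨ y) ≈ (¬ x) ∧ y
      ¬x∧[x∨y]≈¬x∧y = trans (∧-distribˡ-∨ (¬ x) x y)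
                         (trans (∨-congʳ (∧-complementˡ x)) (∨-identityˡ _))

      ¬x∧y≤y : _≤ᴮ_ B ((¬ x) ∧ y) y
      ¬x∧y≤y = trans (∧-assoc _ _ _) (∧-congˡ (∧-idem y))

    ultrafilter-⋁ : ∀ xs → U (⋁ xs) → Any U xs
    ultrafilter-⋁ []       U⊥     = Empty.⊥-elim (proper U⊥)
    ultrafilter-⋁ (x ∷ xs) Ux∨⋁xs with ultrafilter-∨ Ux∨⋁xs
    ... | inj₁ Ux   = here Ux
    ... | inj₂ U⋁xs = there (ultrafilter-⋁ xs U⋁xs)

    ultrafilter-∉-¬ : ∀ {x} → U x → U (¬ x) → Empty.⊥
    ultrafilter-∉-¬ {x} Ux U¬x = proper (ultrafilter-resp-≈ (meet Ux U¬x) (∧-complementʳ x))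

module SubordinationProperties {a : Level} (S : SubordinationAlgebra a) where
  open SubordinationAlgebra S
  open BooleanAlgebraProperties booleanAlgebra
  open FilterProperties booleanAlgebra

  ≺-resp-≈ : ∀ {x x' y y'} → x ≈ x' → y ≈ y' → x ≺ y → x' ≺ y'
  ≺-resp-≈ {y = y} x≈x' y≈y' x≺y =
    filter-resp-≈ (≺-filter _) (ideal-resp-≈ (≺-ideal y) x≺y x≈x') y≈y'

  ⊤≺⊤ : ⊤ ≺ ⊤
  ⊤≺⊤ = IsFilter.top∈ (≺-filter ⊤)

  ⊥≺⊥ : ⊥ ≺ ⊥
  ⊥≺⊥ = IsIdeal.bot∈ (≺-ideal ⊥)

  ¬⊤≺¬⊤ : (¬ ⊤) ≺ (¬ ⊤)
  ¬⊤≺¬⊤ = ≺-resp-≈ (sym ¬⊤≈⊥) (sym ¬⊤≈⊥) ⊥≺⊥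

  ¬⊥≺¬⊥ : (¬ ⊥) ≺ (¬ ⊥)
  ¬⊥≺¬⊥ = ≺-resp-≈ (sym ¬⊥≈⊤) (sym ¬⊥≈⊤) ⊤≺⊤

  R-preserves-¬-reflexive : ∀ {x y b} → R S x y → (¬ b) ≺ (¬ b) → x ∋ b → y ∋ b
  R-preserves-¬-reflexive {x} {y} {b} xRy ¬b≺¬b x∋b with IsUltrafilter.prime (proj₂ y) b
  ... | inj₁ y∋b  = y∋b
  ... | inj₂ y∋¬b = Empty.⊥-elim (ultrafilter-∉-¬ (proj₂ x) x∋b (xRy _ _ y∋¬b ¬b≺¬b))

module _ {a : Level} (S T : SubordinationAlgebra a) where

  record IsBisimulation (v : Valuation S) (w : Valuation T)
                        (Z : Ult S → Ult T → Set a) : Set (Level.suc a) where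
    field
      atoms   : ∀ {x y} → Z x y → ∀ p → x ∋ v p ⇔ y ∋ w p
      ◇-forth : ∀ {x y x'} → Z x y → R S x x' → Σ (Ult T) λ y' → R T y y' × Z x' y'
      ◇-back  : ∀ {x y y'} → Z x y → R T y y' → Σ (Ult S) λ x' → R S x x' × Z x' y'
      ◆-forth : ∀ {x y x'} → Z x y → R S x' x → Σ (Ult T) λ y' → R T y' y × Z x' y'
      ◆-back  : ∀ {x y y'} → Z x y → R T y' y → Σ (Ult S) λ x' → R S x' x × Z x' y'

module _ {a : Level} {X Y : Set (Level.suc a)} (Z : X → Y → Set a) where

  Σ-⇔-bisimilar : ∀ {ℓ} {RX : X → Set a} {RY : Y → Set a} {P : X → Set ℓ} {Q : Y → Set ℓ} →
    (∀ {x} → RX x → Σ Y λ y → RY y × Z x y) →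
    (∀ {y} → RY y → Σ X λ x → RX x × Z x y) →
    (∀ {x y} → Z x y → P x ⇔ Q y) →
    (Σ X λ x → Level.Lift ℓ (RX x) × P x) ⇔ (Σ Y λ y → Level.Lift ℓ (RY y) × Q y)
  Σ-⇔-bisimilar forth back P⇔Q = mk⇔
    (λ { (x , lift rx , px) → let (y , ry , z) = forth rx in y , lift ry , to (P⇔Q z) px })
    (λ { (y , lift ry , qy) → let (x , rx , z) = back ry in x , lift rx , from (P⇔Q z) qy })

module _ {a : Level} {S T : SubordinationAlgebra a} {v : Valuation S} {w : Valuation T}
         {Z : Ult S → Ult T → Set a} (bisim : IsBisimulation S T v w Z) where
  open IsBisimulation bisim

  bisimulation-invariance : ∀ φ {x y} → Z x y → ⟦_⟧ S φ v x ⇔ ⟦_⟧ T φ w y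
  bisimulation-invariance (var p)  z = mk⇔ (λ { (lift h) → lift (to (atoms z p) h) })
                                           (λ { (lift h) → lift (from (atoms z p) h) })
  bisimulation-invariance (φ ∨ᶠ ψ) z = bisimulation-invariance φ z ⊎-⇔ bisimulation-invariance ψ z
  bisimulation-invariance (φ ∧ᶠ ψ) z = bisimulation-invariance φ z ×-⇔ bisimulation-invariance ψ z
  bisimulation-invariance (¬ᶠ φ)   z = mk⇔ (λ ¬h h → ¬h (from φ⇔ h)) (λ ¬h h → ¬h (to φ⇔ h))
    where φ⇔ = bisimulation-invariance φ z
  bisimulation-invariance ⊤ᶠ       z = mk⇔ (λ _ → tt) (λ _ → tt)
  bisimulation-invariance ⊥ᶠ       z = mk⇔ (λ ()) (λ ())
  bisimulation-invariance (◇ φ)    z =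
    Σ-⇔-bisimilar Z (◇-forth z) (◇-back z) (bisimulation-invariance φ)
  bisimulation-invariance (◆ φ)    z =
    Σ-⇔-bisimilar Z (◆-forth z) (◆-back z) (bisimulation-invariance φ)

module Product {a : Level} {n : ℕ} (A : Fin n → SubordinationAlgebra a) where
  private
    module A j = SubordinationAlgebra (A j)
    module AP j = BooleanAlgebraProperties (A.booleanAlgebra j)
    module AF j = FilterProperties (A.booleanAlgebra j)
    module AS j = SubordinationProperties (A j)
    module P = SubordinationAlgebra (∏ A)
    module PF = FilterProperties P.booleanAlgebra
    module PS = SubordinationProperties (∏ A)

  ι : (j : Fin n) → A.Carrier j → P.Carrier
  ι j b i with i ≟ j
  ... | yes refl = b
  ... | no _     = A.⊥ i

  e : Fin n → P.Carrier
  e j = ι j (A.⊤ j)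

  ι-at : ∀ j b → A._≈_ j (ι j b j) b
  ι-at j b with j ≟ j
  ... | yes refl = A.refl j
  ... | no j≢j   = Empty.⊥-elim (j≢j refl)

  ι-mono : ∀ j {b c} → _≤ᴮ_ (A.booleanAlgebra j) b c → _≤ᴮ_ P.booleanAlgebra (ι j b) (ι j c)
  ι-mono j b≤c i with i ≟ j
  ... | yes refl = b≤c
  ... | no _     = AP.∧-idem i _

  ι-∧ : ∀ j b c → P._≈_ (ι j b P.∧ ι j c) (ι j (A._∧_ j b c))
  ι-∧ j b c i with i ≟ j
  ... | yes refl = A.refl i
  ... | no _     = AP.∧-idem i _

  ι-⊥ : ∀ j → P._≈_ (ι j (A.⊥ j)) P.⊥
  ι-⊥ j i with i ≟ j
  ... | yes refl = A.refl i
  ... | no _     = A.refl i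

  ι-≺ : ∀ j {b c} → A._≺_ j b c → P._≺_ (ι j b) (ι j c)
  ι-≺ j b≺c i with i ≟ j
  ... | yes refl = b≺c
  ... | no _     = AS.⊥≺⊥ i

  ∧-e≈ι : ∀ j f → P._≈_ (f P.∧ e j) (ι j (f j))
  ∧-e≈ι j f i with i ≟ j
  ... | yes refl = AP.∧-identityʳ i _
  ... | no _     = AP.∧-zeroʳ i _

  ¬ι∧e≈ι¬ : ∀ j b → P._≈_ (P.¬_ (ι j b) P.∧ e j) (ι j (A.¬_ j b))
  ¬ι∧e≈ι¬ j b = P.trans (∧-e≈ι j (P.¬_ (ι j b))) (ι-cong (A.¬-cong j (ι-at j b)))
    where
    ι-cong : ∀ {b c} → A._≈_ j b c → P._≈_ (ι j b) (ι j c)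
    ι-cong b≈c i with i ≟ j
    ... | yes refl = b≈c
    ... | no _     = A.refl i

  ι-proj≤ : ∀ j f → _≤ᴮ_ P.booleanAlgebra (ι j (f j)) f
  ι-proj≤ j f i with i ≟ j
  ... | yes refl = AP.∧-idem i _
  ... | no _     = AP.∧-zeroˡ i _

  e≺e : ∀ j → P._≺_ (e j) (e j)
  e≺e j = ι-≺ j (AS.⊤≺⊤ j)

  ¬e≺¬e : ∀ j → P._≺_ (P.¬_ (e j)) (P.¬_ (e j))
  ¬e≺¬e j i with i ≟ j
  ... | yes refl = AS.¬⊤≺¬⊤ i
  ... | no _     = AS.¬⊥≺¬⊥ i

  ⋁e-covers : ∀ js i → i ∈ js → A._≈_ i (PF.⋁ (map e js) i) (A.⊤ i)
  ⋁e-covers (j ∷ js) i (here refl) = A.trans i (A.∨-congʳ i (ι-at i (A.⊤ i))) (AP.∨-zeroˡ i _)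
  ⋁e-covers (j ∷ js) i (there i∈js) = A.trans i (A.∨-congˡ i (⋁e-covers js i i∈js)) (AP.∨-zeroʳ i _)

  ultrafilter-∋-e : (X : Ult (∏ A)) → Σ (Fin n) λ j → X ∋ e j
  ultrafilter-∋-e (U , isU) =
    satisfied (Any.map⁻ (PF.ultrafilter-⋁ isU (map e (allFin n)) U⋁e))
    where
    U⋁e : U (PF.⋁ (map e (allFin n)))
    U⋁e = PF.ultrafilter-resp-≈ isU (IsFilter.top∈ (IsUltrafilter.isFilter isU))
            (λ i → A.sym i (⋁e-covers (allFin n) i (∈-allFin i)))

  lift-ultrafilter : (j : Fin n) → Ult (A j) → Ult (∏ A)
  lift-ultrafilter j x = (λ f → x ∋ f j) , record
    { isFilter = record
      { top∈   = top∈
      ; upward = λ Uf f≤g → upward Uf (f≤g j)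
      ; meet   = meet }
    ; proper = proper
    ; prime  = λ f → prime (f j) }
    where
    open IsUltrafilter (proj₂ x)
    open IsFilter isFilter

  project-ultrafilter : (j : Fin n) (X : Ult (∏ A)) → X ∋ e j → Ult (A j)
  project-ultrafilter j (U , isU) Ue = (λ b → U (ι j b)) , record
    { isFilter = record
      { top∈   = Ue
      ; upward = λ Ub b≤c → upward Ub (ι-mono j b≤c)
      ; meet   = λ Ub Uc → PF.ultrafilter-resp-≈ isU (meet Ub Uc) (ι-∧ j _ _) }
    ; proper = λ Uι⊥ → proper (PF.ultrafilter-resp-≈ isU Uι⊥ (ι-⊥ j))
    ; prime  = λ b → map₂ (λ U¬ιb → PF.ultrafilter-resp-≈ isU (meet U¬ιb Ue) (¬ι∧e≈ι¬ j b))
                                   (prime (ι j b)) }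
    where
    open IsUltrafilter isU
    open IsFilter isFilter

  Corresponds : (j : Fin n) → Ult (∏ A) → Ult (A j) → Set a
  Corresponds j X x = ∀ f → X ∋ f ⇔ x ∋ f j

  lift-corresponds : ∀ j x → Corresponds j (lift-ultrafilter j x) x
  lift-corresponds j x f = mk⇔ (λ h → h) (λ h → h)

  project-corresponds : ∀ j X (X∋e : X ∋ e j) → Corresponds j X (project-ultrafilter j X X∋e)
  project-corresponds j (U , isU) Ue f = mk⇔
    (λ Uf → PF.ultrafilter-resp-≈ isU (meet Uf Ue) (∧-e≈ι j f))
    (λ Uιf → upward Uιf (ι-proj≤ j f))
    where
    open IsFilter (IsUltrafilter.isFilter isU)

  module _ {j : Fin n} {X : Ult (∏ A)} {x : Ult (A j)} (X~x : Corresponds j X x) where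

    corresponds-ι : ∀ b → X ∋ ι j b ⇔ x ∋ b
    corresponds-ι b = mk⇔
      (λ X∋ιb → AF.ultrafilter-resp-≈ j (proj₂ x) (to (X~x (ι j b)) X∋ιb) (ι-at j b))
      (λ x∋b → from (X~x (ι j b)) (AF.ultrafilter-resp-≈ j (proj₂ x) x∋b (A.sym j (ι-at j b))))

    corresponds-∋-e : X ∋ e j
    corresponds-∋-e = from (corresponds-ι (A.⊤ j))
      (IsFilter.top∈ (IsUltrafilter.isFilter (proj₂ x)))

  corresponds-isBisimulation : ∀ j (V : Valuation (∏ A)) (v : Valuation (A j)) →
    (∀ p → A._≈_ j (V p j) (v p)) → IsBisimulation (∏ A) (A j) V v (Corresponds j)
  corresponds-isBisimulation j V v V≈v = record
    { atoms   = λ {X} {x} X~x p → mk⇔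
        (λ X∋V → AF.ultrafilter-resp-≈ j (proj₂ x) (to (X~x (V p)) X∋V) (V≈v p))
        (λ x∋v → from (X~x (V p)) (AF.ultrafilter-resp-≈ j (proj₂ x) x∋v (A.sym j (V≈v p))))
    ; ◇-forth = λ {X} {x} {Y} X~x XRY →
        let Y∋e = PS.R-preserves-¬-reflexive {x = X} {y = Y} XRY (¬e≺¬e j) (corresponds-∋-e {X = X} {x = x} X~x) in
        project-ultrafilter j Y Y∋e
        , (λ b c Y∋ιb b≺c → to (corresponds-ι {X = X} {x = x} X~x c) (XRY _ _ Y∋ιb (ι-≺ j b≺c)))
        , project-corresponds j Y Y∋e
    ; ◇-back  = λ {X} {x} {y} X~x xRy →
        lift-ultrafilter j y
        , (λ f g y∋fj f≺g → from (X~x g) (xRy _ _ y∋fj (f≺g j)))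
        , lift-corresponds j y
    ; ◆-forth = λ {X} {x} {Y} X~x YRX →
        let Y∋e = YRX _ _ (corresponds-∋-e {X = X} {x = x} X~x) (e≺e j) in
        project-ultrafilter j Y Y∋e
        , (λ b c x∋b b≺c → YRX _ _ (from (corresponds-ι {X = X} {x = x} X~x b) x∋b) (ι-≺ j b≺c))
        , project-corresponds j Y Y∋e
    ; ◆-back  = λ {X} {x} {y} X~x yRx →
        lift-ultrafilter j y
        , (λ f g X∋f f≺g → yRx _ _ (to (X~x f) X∋f) (f≺g j))
        , lift-corresponds j y }

proposition2p24 : {a : Level} (φ : Formula) (n : ℕ) (A : Fin n → SubordinationAlgebra a) →
    (∏ A ⊨ φ) ⇔ (∀ (j : Fin n) → A j ⊨ φ)
proposition2p24 φ n A = mk⇔ product⇒factors factors⇒product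
  where
  open Product A

  product⇒factors : ∏ A ⊨ φ → ∀ j → A j ⊨ φ
  product⇒factors ⊨φ j v x =
    to (bisimulation-invariance (corresponds-isBisimulation j V v (λ p → ι-at j (v p))) φ
                                (lift-corresponds j x))
       (⊨φ V (lift-ultrafilter j x))
    where
    V : Valuation (∏ A)
    V p = ι j (v p)

  factors⇒product : (∀ j → A j ⊨ φ) → ∏ A ⊨ φ
  factors⇒product ⊨φ V X =
    let (j , X∋e) = ultrafilter-∋-e X in
    from (bisimulation-invariance (corresponds-isBisimulation j V (λ p → V p j) (λ p → A.refl j)) φ
                                  (project-corresponds j X X∋e))
         (⊨φ j (λ p → V p j) (project-ultrafilter j X X∋e))
    where
    module A j = SubordinationAlgebra (A j)
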